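{- There exists a tree with $n$ vertices that has an eigenvector for eigenvalue $1$ with all entries in $\{1,-1\}$ if and only if $n\equiv 2 \pmod 4$.
   Context: Eigenvalues and eigenvectors of a graph are those of its adjacency matrix; an eigenvector is a non-zero vector $x$ indexed by the vertices with $Ax=\lambda x$. -}

module Defs where

open import Data.Nat using (ℕ; _≤_)
open import Data.Fin using (Fin)
open import Data.Bool using (Bool; true; false; T; if_then_else_)
open import Data.Integer using (ℤ; _+_; _*_; +_; -_; 0ℤ; 1ℤ)
open import Data.List using (List; []; _∷_; _∷ʳ_; length)
open import Data.List.Relation.Unary.Linked using (Linked)
open import Data.List.Relation.Unary.Unique.Propositional using (Unique)
open import Data.Product using (Σ; ∃; _×_)
open import Data.Sum using (_⊎_)
open import Relation.Binary.PropositionalEquality using (_≡_; _≢_)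
open import Relation.Nullary using (¬_)
import Data.Vec.Functional as VF

record Graph (n : ℕ) : Set where
  field
    adj   : Fin n → Fin n → Bool
    sym   : ∀ u v → adj u v ≡ adj v u
    irrefl : ∀ u → adj u u ≡ false

open Graph public

Adj : ∀ {n} → Graph n → Fin n → Fin n → Set
Adj G u v = T (adj G u v)

Connected : ∀ {n} → Graph n → Set
Connected {n} G = ∀ (u v : Fin n) →
  u ≡ v ⊎ Σ (List (Fin n)) (λ xs → Linked (Adj G) (u ∷ xs ∷ʳ v))

HasCycle : ∀ {n} → Graph n → Set
HasCycle {n} G = Σ (Fin n) λ u → Σ (List (Fin n)) λ ys →
  (2 ≤ length ys) × Unique (u ∷ ys) × Linked (Adj G) (u ∷ ys ∷ʳ u)

IsTree : ∀ {n} → Graph n → Set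
IsTree G = Connected G × ¬ HasCycle G

adjMatrix : ∀ {n} → Graph n → Fin n → Fin n → ℤ
adjMatrix G u v = if adj G u v then 1ℤ else 0ℤ

sumFin : ∀ {n} → (Fin n → ℤ) → ℤ
sumFin f = VF.foldr _+_ 0ℤ f

IsEigenvector : ∀ {n} → Graph n → (Fin n → ℤ) → ℤ → Set
IsEigenvector {n} G x λ′ =
  (Σ (Fin n) λ i → x i ≢ 0ℤ) ×
  (∀ u → sumFin (λ v → adjMatrix G u v * x v) ≡ λ′ * x u)

PlusMinusOne : ∀ {n} → (Fin n → ℤ) → Set
PlusMinusOne x = ∀ i → x i ≡ 1ℤ ⊎ x i ≡ - 1ℤ

-- Let x be a ±1 eigenvector of a tree with n vertices for the eigenvalue 1.  Then
-- Σ_u x_u (Ax)_u = Σ_u x_u² = n, while on every edge x_u x_v = 1 - 2·[x_u ≠ x_v], so the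
-- same double sum equals 2(n - 1) - 4d, where d counts the edges whose ends have different
-- signs: hence n = 2 + 4d.  The edge count of a tree enters through Σ_u Σ_v A_uv = 2(n - 1),
-- proved by deleting leaves one at a time.  Conversely, starting from an edge signed (+1, +1)
-- and repeatedly attaching to the root a leaf signed +1 and a vertex signed -1 carrying two
-- leaves signed -1 keeps x an eigenvector and produces trees of every order 4m + 2.

module Submission where

open import Defs hiding (sym)
open import Data.Bool using (Bool; true; false; T; not; _∧_; _∨_; if_then_else_)
open import Data.Bool.Properties using (∨-comm)
open import Data.Unit using (⊤; tt)
open import Data.Empty using (⊥; ⊥-elim)
open import Function using (_∘_; id; _⇔_; mk⇔)
open import Data.Fin using (Fin; zero; suc; _≟_; toℕ)
open import Data.Fin.Patterns using (0F; 1F; 2F; 3F)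
open import Data.Integer as ℤ using (ℤ; -_; -1ℤ; _+_; _*_; 0ℤ; 1ℤ)
import Data.Fin.Properties as Fin
import Data.Integer.Properties as ℤ
open import Data.Nat as ℕ using (ℕ; zero; suc; z≤n; s≤s; _%_; _/_)
open import Data.Nat.DivMod using ([m+kn]%n≡m%n; m≡m%n+[m/n]*n)
import Data.Nat.Properties as ℕ
open import Data.Nat.Tactic.RingSolver using (solve-∀)
open import Data.Integer.Tactic.RingSolver renaming (solve-∀ to ℤ-solve-∀)
open import Data.Product using (Σ; ∃; ∃₂; _×_; _,_; proj₁; proj₂)
open import Data.List using (List; []; _∷_; _++_; _∷ʳ_; length; lookup; InitLast; initLast; _∷ʳ′_)
open import Data.List.Membership.Propositional.Properties using (∈-lookup; ∈-∃++)
open import Data.List.Relation.Unary.All as All using (All; []; _∷_)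
import Data.List.Relation.Unary.Any as Any
import Data.List.Relation.Unary.All.Properties as All
open import Data.List.Relation.Unary.AllPairs using ([]; _∷_)
open import Data.List.Relation.Unary.Linked as Linked using (Linked; [-]; _∷_)
open import Data.List.Relation.Unary.Unique.Propositional using (Unique)
open import Data.Sum using (_⊎_; inj₁; inj₂)
open import Relation.Binary.Construct.Closure.ReflexiveTransitive as Star using (Star; ε; _◅_; _◅◅_)
open import Relation.Binary.PropositionalEquality
open import Relation.Nullary using (¬_; yes; no; does)
open import Relation.Nullary.Decidable using (T?; ¬?; _×-dec_; decidable-stable; does-⇔; dec-true)
import Algebra.Properties.Semiring.Sum as Sum

module ℤΣ = Sum ℤ.+-*-semiring
module ℕΣ = Sum ℕ.+-*-semiring

χ : Bool → ℤ
χ b = if b then 1ℤ else 0ℤ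

δ : ∀ {n} → Fin n → Fin n → ℤ
δ i j = χ (does (i ≟ j))

sum-zero : ∀ {n} {f : Fin n → ℤ} → (∀ i → f i ≡ 0ℤ) → sumFin f ≡ 0ℤ
sum-zero {n} f≗0 = trans (ℤΣ.sum-cong-≗ f≗0) (ℤΣ.sum-replicate-zero n)

sum-δ : ∀ {n} (j : Fin n) (f : Fin n → ℤ) → sumFin (λ i → δ i j * f i) ≡ f j
sum-δ {suc n} zero f = begin
  1ℤ * f zero + sumFin {n} (λ _ → 0ℤ) ≡⟨ cong₂ _+_ (ℤ.*-identityˡ (f zero)) (sum-zero {n} (λ _ → refl)) ⟩
  f zero + 0ℤ                          ≡⟨ ℤ.+-identityʳ (f zero) ⟩
  f zero                               ∎
  where open ≡-Reasoning
sum-δ {suc n} (suc j) f = trans (ℤ.+-identityˡ (sumFin (λ i → δ i j * f (suc i)))) (sum-δ j (f ∘ suc))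

sum-δ-1 : ∀ {n} (j : Fin n) → sumFin (λ i → δ i j) ≡ 1ℤ
sum-δ-1 j = trans (ℤΣ.sum-cong-≗ (λ i → sym (ℤ.*-identityʳ (δ i j)))) (sum-δ j (λ _ → 1ℤ))

sum-fromℕ : ∀ {n} (f : Fin n → ℕ) → sumFin (λ i → ℤ.+ f i) ≡ ℤ.+ ℕΣ.sum f
sum-fromℕ {zero} f = refl
sum-fromℕ {suc n} f = cong (ℤ.+ f zero +_) (sum-fromℕ (λ i → f (suc i)))

∑∑-distrib-+ : ∀ {n} (f g : Fin n → Fin n → ℤ) →
               sumFin (λ u → sumFin (λ v → f u v + g u v)) ≡
               sumFin (λ u → sumFin (f u)) + sumFin (λ u → sumFin (g u))
∑∑-distrib-+ f g = trans (ℤΣ.sum-cong-≗ (λ u → ℤΣ.∑-distrib-+ (f u) (g u)))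
                         (ℤΣ.∑-distrib-+ (λ u → sumFin (f u)) (λ u → sumFin (g u)))

sum-symmetric-even : ∀ {n} (M : Fin n → Fin n → ℕ) → (∀ u v → M u v ≡ M v u) → (∀ u → M u u ≡ 0) →
                     ∃ λ k → ℕΣ.sum (λ u → ℕΣ.sum (M u)) ≡ k ℕ.+ k
sum-symmetric-even {zero} M sym-M diag-M = 0 , refl
sum-symmetric-even {suc n} M sym-M diag-M =
  let k , inner = sum-symmetric-even (λ u v → M (suc u) (suc v)) (λ u v → sym-M (suc u) (suc v)) (diag-M ∘ suc)
  in row ℕ.+ k , (begin
    (M zero zero ℕ.+ row) ℕ.+ ℕΣ.sum (λ u → M (suc u) zero ℕ.+ ℕΣ.sum (λ v → M (suc u) (suc v)))
      ≡⟨ cong₂ ℕ._+_ (cong (ℕ._+ row) (diag-M zero)) (ℕΣ.∑-distrib-+ (λ u → M (suc u) zero) _) ⟩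
    row ℕ.+ (column ℕ.+ ℕΣ.sum (λ u → ℕΣ.sum (λ v → M (suc u) (suc v))))
      ≡⟨ cong₂ (λ c s → row ℕ.+ (c ℕ.+ s)) (ℕΣ.sum-cong-≗ (λ u → sym-M (suc u) zero)) inner ⟩
    row ℕ.+ (row ℕ.+ (k ℕ.+ k))
      ≡⟨ regroup row k ⟩
    (row ℕ.+ k) ℕ.+ (row ℕ.+ k) ∎)
  where
  open ≡-Reasoning
  regroup : ∀ a b → a ℕ.+ (a ℕ.+ (b ℕ.+ b)) ≡ (a ℕ.+ b) ℕ.+ (a ℕ.+ b)
  regroup = solve-∀
  row column : ℕ
  row = ℕΣ.sum (λ v → M zero (suc v))
  column = ℕΣ.sum (λ u → M (suc u) zero)

χ-T : ∀ {b} → T b → χ b ≡ 1ℤ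
χ-T {true} _ = refl

χ-¬T : ∀ {b} → ¬ T b → χ b ≡ 0ℤ
χ-¬T {false} _  = refl
χ-¬T {true}  ¬t = ⊥-elim (¬t tt)

lookup-injective : ∀ {A : Set} {xs : List A} → Unique xs → ∀ {i j} → lookup xs i ≡ lookup xs j → i ≡ j
lookup-injective (_ ∷ _)  {zero}  {zero}  _  = refl
lookup-injective (x∉ ∷ _) {zero}  {suc j} eq = ⊥-elim (All.lookup x∉ (∈-lookup j) eq)
lookup-injective (x∉ ∷ _) {suc i} {zero}  eq = ⊥-elim (All.lookup x∉ (∈-lookup i) (sym eq))
lookup-injective (_ ∷ u)  {suc i} {suc j} eq = cong suc (lookup-injective u eq)

Unique⇒length≤ : ∀ {n} {xs : List (Fin n)} → Unique xs → length xs ℕ.≤ n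
Unique⇒length≤ u = Fin.injective⇒≤ (lookup-injective u)

Unique-++-∷⇒∷ : ∀ {A : Set} xs {y : A} {ys} → Unique (xs ++ y ∷ ys) → Unique (y ∷ xs)
Unique-++-∷⇒∷ []       _          = [] ∷ []
Unique-++-∷⇒∷ (x ∷ xs) (x∉ ∷ uxs) with Unique-++-∷⇒∷ xs uxs
... | y∉ ∷ uxs′ = (y≢x ∷ y∉) ∷ (All.++⁻ˡ xs x∉ ∷ uxs′)
  where y≢x = λ y≡x → All.head (All.++⁻ʳ xs x∉) (sym y≡x)

Linked-++-∷⇒∷ʳ : ∀ {A : Set} {R : A → A → Set} xs {y ys} → Linked R (xs ++ y ∷ ys) → Linked R (xs ∷ʳ y)
Linked-++-∷⇒∷ʳ []            _       = [-]
Linked-++-∷⇒∷ʳ (x ∷ [])      (r ∷ _) = r ∷ [-]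
Linked-++-∷⇒∷ʳ (x ∷ x′ ∷ xs) (r ∷ l) = r ∷ Linked-++-∷⇒∷ʳ (x′ ∷ xs) l

Linked⇒Star : ∀ {A : Set} {R : A → A → Set} {u} xs {v} → Linked R (u ∷ xs ∷ʳ v) → Star R u v
Linked⇒Star []       (r ∷ [-]) = r ◅ ε
Linked⇒Star (x ∷ xs) (r ∷ l)   = r ◅ Linked⇒Star xs l

Star⇒Linked : ∀ {A : Set} {R : A → A → Set} {u v} → Star R u v → u ≡ v ⊎ ∃ λ xs → Linked R (u ∷ xs ∷ʳ v)
Star⇒Linked ε = inj₁ refl
Star⇒Linked (r ◅ walk) with Star⇒Linked walk
... | inj₁ refl      = inj₂ ([] , r ∷ [-])
... | inj₂ (xs , l) = inj₂ (_ ∷ xs , r ∷ l)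

NonBacktracking : ∀ {A : Set} → List A → Set
NonBacktracking (a ∷ b ∷ c ∷ rest) = a ≢ c × NonBacktracking (b ∷ c ∷ rest)
NonBacktracking _                  = ⊤

NonBacktracking-tail : ∀ {A : Set} {a : A} xs → NonBacktracking (a ∷ xs) → NonBacktracking xs
NonBacktracking-tail []          _        = tt
NonBacktracking-tail (_ ∷ [])    _        = tt
NonBacktracking-tail (_ ∷ _ ∷ _) (_ , nb) = nb

Unique⇒NonBacktracking : ∀ {A : Set} ws {z : A} → Unique ws → All (z ≢_) ws → NonBacktracking (ws ∷ʳ z)
Unique⇒NonBacktracking []               _                         _         = tt
Unique⇒NonBacktracking (_ ∷ [])         _                         _         = tt
Unique⇒NonBacktracking (_ ∷ _ ∷ [])     _                         (z≢a ∷ _) = (λ a≡z → z≢a (sym a≡z)) , tt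
Unique⇒NonBacktracking (_ ∷ b ∷ c ∷ ws) ((_ ∷ a≢c ∷ _) ∷ simple) (_ ∷ z∉)  =
  a≢c , Unique⇒NonBacktracking (b ∷ c ∷ ws) simple z∉

cycle⇒NonBacktracking : ∀ {A : Set} {u : A} ys → 2 ℕ.≤ length ys → Unique (u ∷ ys) → NonBacktracking (u ∷ ys ∷ʳ u)
cycle⇒NonBacktracking []             ()         _
cycle⇒NonBacktracking (_ ∷ [])       (s≤s ())   _
cycle⇒NonBacktracking (y₁ ∷ y₂ ∷ ys) _ (u∉@(_ ∷ u≢y₂ ∷ _) ∷ simple) = u≢y₂ , Unique⇒NonBacktracking (y₁ ∷ y₂ ∷ ys) simple u∉

VertexSet : ℕ → Set
VertexSet n = Fin n → Bool

_─_ : ∀ {n} → VertexSet n → Fin n → VertexSet n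
(s ─ ℓ) v = not (does (v ≟ ℓ)) ∧ s v

size : ∀ {n} → VertexSet n → ℕ
size s = ℕΣ.sum (λ v → if s v then 1 else 0)

size-full : ∀ n → size {n} (λ _ → true) ≡ n
size-full zero    = refl
size-full (suc n) = cong suc (size-full n)

module _ {n} (s : VertexSet n) {ℓ : Fin n} where

  ─⁺ : ∀ {v} → T (s v) → v ≢ ℓ → T ((s ─ ℓ) v)
  ─⁺ {v} v∈s v≢ℓ with v ≟ ℓ
  ... | yes v≡ℓ = ⊥-elim (v≢ℓ v≡ℓ)
  ... | no _    = v∈s

  ─⁻ : ∀ {v} → T ((s ─ ℓ) v) → T (s v) × v ≢ ℓ
  ─⁻ {v} v∈s′ with v ≟ ℓ
  ... | no v≢ℓ = v∈s′ , v≢ℓ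

  χ-─ : T (s ℓ) → ∀ u → χ (s u) ≡ χ ((s ─ ℓ) u) + δ u ℓ
  χ-─ ℓ∈s u with u ≟ ℓ
  ... | yes refl = χ-T ℓ∈s
  ... | no _     = sym (ℤ.+-identityʳ _)

  sum-χ-─ : T (s ℓ) → ∀ f → sumFin (λ u → χ (s u) * f u) ≡ sumFin (λ u → χ ((s ─ ℓ) u) * f u) + f ℓ
  sum-χ-─ ℓ∈s f = begin
    sumFin (λ u → χ (s u) * f u)
      ≡⟨ ℤΣ.sum-cong-≗ (λ u → cong (_* f u) (χ-─ ℓ∈s u)) ⟩
    sumFin (λ u → (χ ((s ─ ℓ) u) + δ u ℓ) * f u)
      ≡⟨ ℤΣ.sum-cong-≗ (λ u → ℤ.*-distribʳ-+ (f u) (χ ((s ─ ℓ) u)) (δ u ℓ)) ⟩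
    sumFin (λ u → χ ((s ─ ℓ) u) * f u + δ u ℓ * f u)
      ≡⟨ ℤΣ.∑-distrib-+ (λ u → χ ((s ─ ℓ) u) * f u) (λ u → δ u ℓ * f u) ⟩
    sumFin (λ u → χ ((s ─ ℓ) u) * f u) + sumFin (λ u → δ u ℓ * f u)
      ≡⟨ cong (sumFin (λ u → χ ((s ─ ℓ) u) * f u) +_) (sum-δ ℓ f) ⟩
    sumFin (λ u → χ ((s ─ ℓ) u) * f u) + f ℓ ∎
    where open ≡-Reasoning

size-─ : ∀ {n} (s : VertexSet n) {ℓ} → T (s ℓ) → size s ≡ suc (size (s ─ ℓ))
size-─ {suc n} s {zero} ℓ∈s with s zero
... | true = refl
size-─ {suc n} s {suc ℓ} ℓ∈s =
  trans (cong (c ℕ.+_) (size-─ (s ∘ suc) ℓ∈s)) (ℕ.+-suc c _)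
  where c = if s zero then 1 else 0

inhabited : ∀ {n} (s : VertexSet n) {k} → size s ≡ suc k → ∃ λ u → T (s u)
inhabited {suc n} s eq with s zero in s₀
... | true  = zero , subst T (sym s₀) tt
... | false = let u , u∈s = inhabited (s ∘ suc) eq in suc u , u∈s

size≡1⇒singleton : ∀ {n} (s : VertexSet n) → size s ≡ 1 → ∀ {u v} → T (s u) → T (s v) → u ≡ v
size≡1⇒singleton s |s|≡1 {u} {v} u∈s v∈s with v ≟ u
... | yes v≡u = sym v≡u
... | no v≢u  = ⊥-elim (ℕ.0≢1+n (trans (sym |s∖u|≡0) (size-─ (s ─ u) (─⁺ s v∈s v≢u))))
  where |s∖u|≡0 = ℕ.suc-injective (trans (sym (size-─ s u∈s)) |s|≡1)

two-members : ∀ {n} (s : VertexSet n) {k} → size s ≡ suc (suc k) → ∃₂ λ u v → T (s u) × T (s v) × u ≢ v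
two-members s |s|≡2+k
  with u , u∈s ← inhabited s |s|≡2+k
  with v , v∈s∖u ← inhabited (s ─ u) (ℕ.suc-injective (trans (sym (size-─ s u∈s)) |s|≡2+k))
  with v∈s , v≢u ← ─⁻ s v∈s∖u
  = u , v , u∈s , v∈s , v≢u ∘ sym

module _ {n} (G : Graph n) where

  Adj-sym : ∀ {u v} → Adj G u v → Adj G v u
  Adj-sym {u} {v} = subst T (Graph.sym G u v)

  Adj-irrefl : ∀ {u v} → Adj G u v → u ≢ v
  Adj-irrefl {u} u~u refl = subst T (Graph.irrefl G u) u~u

  degreeIn : VertexSet n → Fin n → ℤ
  degreeIn s u = sumFin (λ v → χ (s v) * adjMatrix G u v)

  degreeSum : VertexSet n → ℤ
  degreeSum s = sumFin (λ u → χ (s u) * degreeIn s u)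

  degreeSum-─ : ∀ {s ℓ} → T (s ℓ) → degreeSum s ≡ degreeSum (s ─ ℓ) + (degreeIn s ℓ + degreeIn s ℓ)
  degreeSum-─ {s} {ℓ} ℓ∈s = begin
    degreeSum s
      ≡⟨ sum-χ-─ s ℓ∈s (degreeIn s) ⟩
    sumFin (λ u → χ (s′ u) * degreeIn s u) + degreeIn s ℓ
      ≡⟨ cong (_+ degreeIn s ℓ) (ℤΣ.sum-cong-≗ λ u → cong (χ (s′ u) *_) (sum-χ-─ s ℓ∈s (adjMatrix G u))) ⟩
    sumFin (λ u → χ (s′ u) * (degreeIn s′ u + adjMatrix G u ℓ)) + degreeIn s ℓ
      ≡⟨ cong (_+ degreeIn s ℓ) (trans (ℤΣ.sum-cong-≗ λ u → ℤ.*-distribˡ-+ (χ (s′ u)) (degreeIn s′ u) (adjMatrix G u ℓ))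
                                     (ℤΣ.∑-distrib-+ (λ u → χ (s′ u) * degreeIn s′ u) (λ u → χ (s′ u) * adjMatrix G u ℓ))) ⟩
    (degreeSum s′ + sumFin (λ u → χ (s′ u) * adjMatrix G u ℓ)) + degreeIn s ℓ
      ≡⟨ cong (λ d → (degreeSum s′ + d) + degreeIn s ℓ) column-ℓ ⟩
    (degreeSum s′ + degreeIn s ℓ) + degreeIn s ℓ
      ≡⟨ ℤ.+-assoc (degreeSum s′) (degreeIn s ℓ) (degreeIn s ℓ) ⟩
    degreeSum s′ + (degreeIn s ℓ + degreeIn s ℓ) ∎
    where
    open ≡-Reasoning
    s′ = s ─ ℓ
    column-ℓ : sumFin (λ u → χ (s′ u) * adjMatrix G u ℓ) ≡ degreeIn s ℓ
    column-ℓ = begin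
      sumFin (λ u → χ (s′ u) * adjMatrix G u ℓ)
        ≡⟨ ℤΣ.sum-cong-≗ (λ u → cong (λ b → χ (s′ u) * χ b) (Graph.sym G u ℓ)) ⟩
      degreeIn s′ ℓ
        ≡⟨ sym (ℤ.+-identityʳ (degreeIn s′ ℓ)) ⟩
      degreeIn s′ ℓ + χ false
        ≡⟨ cong (λ b → degreeIn s′ ℓ + χ b) (sym (Graph.irrefl G ℓ)) ⟩
      degreeIn s′ ℓ + adjMatrix G ℓ ℓ
        ≡⟨ sym (sum-χ-─ s ℓ∈s (adjMatrix G ℓ)) ⟩
      degreeIn s ℓ ∎

  record Leaf (s : VertexSet n) (ℓ p : Fin n) : Set where
    field
      leaf∈       : T (s ℓ)
      neighbour∈  : T (s p)
      adjacent    : Adj G ℓ p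
      only-neighbour : ∀ {v} → T (s v) → Adj G ℓ v → v ≡ p

  degreeIn-leaf : ∀ {s ℓ p} → Leaf s ℓ p → degreeIn s ℓ ≡ 1ℤ
  degreeIn-leaf {s} {ℓ} {p} leaf = trans (ℤΣ.sum-cong-≗ term) (sum-δ-1 p)
    where
    open Leaf leaf
    term : ∀ v → χ (s v) * adjMatrix G ℓ v ≡ δ v p
    term v with v ≟ p
    ... | yes refl = cong₂ _*_ (χ-T neighbour∈) (χ-T adjacent)
    ... | no v≢p with T? (s v) | T? (adj G ℓ v)
    ...   | no v∉s   | _       = cong (_* adjMatrix G ℓ v) (χ-¬T v∉s)
    ...   | yes _    | no ℓ≁v  = trans (cong (χ (s v) *_) (χ-¬T ℓ≁v)) (ℤ.*-zeroʳ (χ (s v)))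
    ...   | yes v∈s  | yes ℓ~v = ⊥-elim (v≢p (only-neighbour v∈s ℓ~v))

  EdgeInto : VertexSet n → Fin n → Fin n → Set
  EdgeInto s a b = Adj G a b × T (s b)

  ConnectedIn : VertexSet n → Set
  ConnectedIn s = ∀ {u v} → T (s u) → T (s v) → Star (EdgeInto s) u v

  ConnectedIn-─ : ∀ {s ℓ p} → Leaf s ℓ p → ConnectedIn s → ConnectedIn (s ─ ℓ)
  ConnectedIn-─ {s} {ℓ} {p} leaf connected u∈ v∈ = avoid (connected (proj₁ (─⁻ s u∈)) (proj₁ (─⁻ s v∈))) u∈ v∈
    where
    open Leaf leaf
    -- A walk through the leaf enters and leaves it via p, so that detour can be cut out.
    avoid : ∀ {u v} → Star (EdgeInto s) u v → T ((s ─ ℓ) u) → T ((s ─ ℓ) v) → Star (EdgeInto (s ─ ℓ)) u v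
    avoid ε _ _ = ε
    avoid (_◅_ {j = w} (u~w , w∈s) walk) u∈s′ v∈s′ with w ≟ ℓ
    ... | no w≢ℓ = (u~w , ─⁺ s w∈s w≢ℓ) ◅ avoid walk (─⁺ s w∈s w≢ℓ) v∈s′
    ... | yes refl with walk
    ...   | ε = ⊥-elim (proj₂ (─⁻ s v∈s′) refl)
    ...   | (ℓ~w′ , w′∈s) ◅ walk′
            with only-neighbour w′∈s ℓ~w′ | only-neighbour (proj₁ (─⁻ s u∈s′)) (Adj-sym u~w)
    ...     | refl | refl = avoid walk′ u∈s′ v∈s′

  degreeSum-edgeless : ∀ s → (∀ {u v} → T (s u) → T (s v) → ¬ Adj G u v) → degreeSum s ≡ 0ℤ
  degreeSum-edgeless s edgeless = sum-zero row
    where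
    row : ∀ u → χ (s u) * degreeIn s u ≡ 0ℤ
    row u with T? (s u)
    ... | no u∉s  = cong (_* degreeIn s u) (χ-¬T u∉s)
    ... | yes u∈s = trans (cong (χ (s u) *_) (sum-zero entry)) (ℤ.*-zeroʳ (χ (s u)))
      where
      entry : ∀ v → χ (s v) * adjMatrix G u v ≡ 0ℤ
      entry v with T? (s v)
      ... | no v∉s  = cong (_* adjMatrix G u v) (χ-¬T v∉s)
      ... | yes v∈s = trans (cong (χ (s v) *_) (χ-¬T (edgeless u∈s v∈s))) (ℤ.*-zeroʳ (χ (s v)))

-- Forests: the number of edges

module Forest {n} (G : Graph n) (acyclic : ¬ HasCycle G) where

  cycleThrough : ∀ {cur prev rest y} pre post → cur ∷ prev ∷ rest ≡ pre ++ y ∷ post →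
                 Linked (Adj G) (cur ∷ prev ∷ rest) → Unique (cur ∷ prev ∷ rest) →
                 Adj G cur y → y ≢ prev → HasCycle G
  cycleThrough []                  _ refl _    _      cur~cur _         = ⊥-elim (Adj-irrefl G cur~cur refl)
  cycleThrough (_ ∷ [])            _ refl _    _      _       prev≢prev = ⊥-elim (prev≢prev refl)
  cycleThrough {y = y} pre@(_ ∷ _ ∷ _) _ refl path simple cur~y _ =
    y , pre , s≤s (s≤s z≤n) , Unique-++-∷⇒∷ pre simple , Adj-sym G cur~y ∷ Linked-++-∷⇒∷ʳ pre path

  -- Walk along a simple path inside s, always to a new neighbour in s; acyclicity
  -- forbids returning to the path and the path cannot outgrow the n vertices.
  leaf-exists : ∀ s {u v} → T (s u) → T (s v) → Adj G u v → ∃₂ (Leaf G s)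
  leaf-exists s u∈s v∈s u~v =
    extend n v∈s u∈s (Adj-sym G u~v ∷ [-]) (((λ v≡u → Adj-irrefl G u~v (sym v≡u)) ∷ []) ∷ [] ∷ []) (ℕ.m≤n+m n 2)
    where
    extend : ∀ fuel {cur prev rest} → T (s cur) → T (s prev) →
             Linked (Adj G) (cur ∷ prev ∷ rest) → Unique (cur ∷ prev ∷ rest) →
             n ℕ.≤ length (cur ∷ prev ∷ rest) ℕ.+ fuel → ∃₂ (Leaf G s)
    extend fuel {cur} {prev} {rest} cur∈s prev∈s path simple bound
      with Fin.any? (λ y → T? (s y) ×-dec T? (adj G cur y) ×-dec ¬? (y ≟ prev))
    ... | no stuck = cur , prev , record
      { leaf∈ = cur∈s ; neighbour∈ = prev∈s ; adjacent = Linked.head path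
      ; only-neighbour = λ {v} v∈s cur~v → decidable-stable (v ≟ prev) (λ v≢prev → stuck (v , v∈s , cur~v , v≢prev)) }
    ... | yes (y , y∈s , cur~y , y≢prev) with Any.any? (y ≟_) (cur ∷ prev ∷ rest)
    ...   | yes y∈path = let pre , post , split = ∈-∃++ y∈path
                         in ⊥-elim (acyclic (cycleThrough pre post split path simple cur~y y≢prev))
    ...   | no y∉path with fuel
    ...     | zero = ⊥-elim (ℕ.≤⇒≯ (subst (n ℕ.≤_) (ℕ.+-identityʳ _) bound) (Unique⇒length≤ simple′))
      where simple′ = All.¬Any⇒All¬ _ y∉path ∷ simple
    ...     | suc fuel′ = extend fuel′ y∈s cur∈s (Adj-sym G cur~y ∷ path) (All.¬Any⇒All¬ _ y∉path ∷ simple)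
                                 (subst (n ℕ.≤_) (ℕ.+-suc _ fuel′) bound)

  degreeSum-connected : ∀ k s → size s ≡ suc k → ConnectedIn G s → degreeSum G s ≡ ℤ.+ (k ℕ.+ k)
  degreeSum-connected zero s |s|≡1 _ =
    degreeSum-edgeless G s (λ u∈s v∈s u~v → Adj-irrefl G u~v (size≡1⇒singleton s |s|≡1 u∈s v∈s))
  degreeSum-connected (suc k) s |s|≡2+k connected
    with u , v , u∈s , v∈s , u≢v ← two-members s |s|≡2+k
    with connected u∈s v∈s
  ... | ε = ⊥-elim (u≢v refl)
  ... | (u~w , w∈s) ◅ _
    with ℓ , p , leaf ← leaf-exists s u∈s w∈s u~w = begin
      degreeSum G s
        ≡⟨ degreeSum-─ G (Leaf.leaf∈ leaf) ⟩
      degreeSum G (s ─ ℓ) + (degreeIn G s ℓ + degreeIn G s ℓ)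
        ≡⟨ cong₂ _+_ (degreeSum-connected k (s ─ ℓ) |s∖ℓ| (ConnectedIn-─ G leaf connected))
                     (cong₂ _+_ (degreeIn-leaf G leaf) (degreeIn-leaf G leaf)) ⟩
      ℤ.+ (k ℕ.+ k) + ℤ.+ 2
        ≡⟨ cong ℤ.+_ (ℕ.+-comm (k ℕ.+ k) 2) ⟩
      ℤ.+ suc (suc (k ℕ.+ k))
        ≡⟨ cong (ℤ.+_ ∘ suc) (sym (ℕ.+-suc k k)) ⟩
      ℤ.+ (suc k ℕ.+ suc k) ∎
    where
    open ≡-Reasoning
    |s∖ℓ| : size (s ─ ℓ) ≡ suc k
    |s∖ℓ| = ℕ.suc-injective (trans (sym (size-─ s (Leaf.leaf∈ leaf))) |s|≡2+k)

tree-adjacencySum : ∀ {k} (G : Graph (suc k)) → IsTree G → sumFin (λ u → sumFin (adjMatrix G u)) ≡ ℤ.+ (k ℕ.+ k)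
tree-adjacencySum {k} G (connected , acyclic) = begin
  sumFin (λ u → sumFin (adjMatrix G u))
    ≡⟨ ℤΣ.sum-cong-≗ (λ u → sym (trans (ℤ.*-identityˡ (degreeIn G (λ _ → true) u))
                                       (ℤΣ.sum-cong-≗ (λ v → ℤ.*-identityˡ (adjMatrix G u v))))) ⟩
  degreeSum G (λ _ → true)
    ≡⟨ Forest.degreeSum-connected G acyclic k (λ _ → true) (size-full (suc k)) connectedIn ⟩
  ℤ.+ (k ℕ.+ k) ∎
  where
  open ≡-Reasoning
  connectedIn : ConnectedIn G (λ _ → true)
  connectedIn {u} {v} _ _ with connected u v
  ... | inj₁ refl         = ε
  ... | inj₂ (xs , walk) = Star.map (_, tt) (Linked⇒Star xs walk)

-- Sign changes of a ±1 eigenvector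

signChange : Bool → ℤ → ℤ → ℕ
signChange edge a c = if edge ∧ not (does (a ℤ.≟ c)) then 1 else 0

χ-sign-split : ∀ b {a c : ℤ} → a ≡ 1ℤ ⊎ a ≡ - 1ℤ → c ≡ 1ℤ ⊎ c ≡ - 1ℤ →
               χ b ≡ a * (χ b * c) + (ℤ.+ signChange b a c + ℤ.+ signChange b a c)
χ-sign-split true  (inj₁ refl) (inj₁ refl) = refl
χ-sign-split true  (inj₁ refl) (inj₂ refl) = refl
χ-sign-split true  (inj₂ refl) (inj₁ refl) = refl
χ-sign-split true  (inj₂ refl) (inj₂ refl) = refl
χ-sign-split false (inj₁ refl) (inj₁ refl) = refl
χ-sign-split false (inj₁ refl) (inj₂ refl) = refl
χ-sign-split false (inj₂ refl) (inj₁ refl) = refl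
χ-sign-split false (inj₂ refl) (inj₂ refl) = refl

±1-square : ∀ {a} → a ≡ 1ℤ ⊎ a ≡ - 1ℤ → a * (1ℤ * a) ≡ 1ℤ
±1-square (inj₁ refl) = refl
±1-square (inj₂ refl) = refl

signChanges : ∀ {n} → Graph n → (Fin n → ℤ) → Fin n → Fin n → ℕ
signChanges G x u v = signChange (adj G u v) (x u) (x v)

signChanges-even : ∀ {n} (G : Graph n) x → ∃ λ j → sumFin (λ u → sumFin (λ v → ℤ.+ signChanges G x u v)) ≡ ℤ.+ (j ℕ.+ j)
signChanges-even G x = let j , even = sum-symmetric-even (signChanges G x) N-sym N-diag in j , (begin
  sumFin (λ u → sumFin (λ v → ℤ.+ signChanges G x u v))  ≡⟨ ℤΣ.sum-cong-≗ (λ u → sum-fromℕ (signChanges G x u)) ⟩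
  sumFin (λ u → ℤ.+ ℕΣ.sum (signChanges G x u))          ≡⟨ sum-fromℕ (λ u → ℕΣ.sum (signChanges G x u)) ⟩
  ℤ.+ ℕΣ.sum (λ u → ℕΣ.sum (signChanges G x u))          ≡⟨ cong ℤ.+_ even ⟩
  ℤ.+ (j ℕ.+ j)                                           ∎)
  where
  open ≡-Reasoning
  N-sym : ∀ u v → signChanges G x u v ≡ signChanges G x v u
  N-sym u v = cong₂ (λ e d → if e ∧ not d then 1 else 0)
                    (Graph.sym G u v) (does-⇔ (mk⇔ sym sym) (x u ℤ.≟ x v) (x v ℤ.≟ x u))
  N-diag : ∀ u → signChanges G x u u ≡ 0
  N-diag u = cong (λ e → if e ∧ not (does (x u ℤ.≟ x u)) then 1 else 0) (Graph.irrefl G u)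

±1-eigenvector-quadraticForm : ∀ {n} (G : Graph n) x → (∀ u → sumFin (λ v → adjMatrix G u v * x v) ≡ 1ℤ * x u) →
                               PlusMinusOne x → sumFin (λ u → sumFin (λ v → x u * (adjMatrix G u v * x v))) ≡ ℤ.+ n
±1-eigenvector-quadraticForm {n} G x eigen ±1 = begin
  sumFin (λ u → sumFin (λ v → x u * (adjMatrix G u v * x v)))
    ≡⟨ ℤΣ.sum-cong-≗ (λ u → trans (sym (ℤΣ.*-distribˡ-sum (x u) (λ v → adjMatrix G u v * x v)))
                                  (cong (x u *_) (eigen u))) ⟩
  sumFin (λ u → x u * (1ℤ * x u))
    ≡⟨ ℤΣ.sum-cong-≗ (λ u → ±1-square (±1 u)) ⟩
  sumFin {n} (λ _ → ℤ.+ 1)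
    ≡⟨ sum-fromℕ {n} (λ _ → 1) ⟩
  ℤ.+ size {n} (λ _ → true)
    ≡⟨ cong ℤ.+_ (size-full n) ⟩
  ℤ.+ n ∎
  where open ≡-Reasoning

order : ℕ → ℕ
order m = 2 ℕ.+ m ℕ.* 4

order-from-handshake : ∀ k j → k ℕ.+ k ≡ suc k ℕ.+ ((j ℕ.+ j) ℕ.+ (j ℕ.+ j)) → suc k ≡ order j
order-from-handshake k j eq = cong suc (ℕ.+-cancelˡ-≡ k _ _ (trans eq (regroup k j)))
  where
  regroup : ∀ k j → suc k ℕ.+ ((j ℕ.+ j) ℕ.+ (j ℕ.+ j)) ≡ k ℕ.+ suc (j ℕ.* 4)
  regroup = solve-∀

EigenTree : ℕ → Set
EigenTree n = Σ (Graph n) λ G → IsTree G × Σ (Fin n → ℤ) λ x → IsEigenvector G x 1ℤ × PlusMinusOne x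

±1-eigentree⇒order : ∀ {n} → EigenTree n → ∃ λ j → n ≡ order j
±1-eigentree⇒order {zero}  (_ , _ , _ , ((() , _) , _) , _)
±1-eigentree⇒order {suc k} (G , isTree , x , (_ , eigen) , ±1) with j , ΣΣN≡2j ← signChanges-even G x =
  j , order-from-handshake k j (ℤ.+-injective (begin
    ℤ.+ (k ℕ.+ k)
      ≡⟨ tree-adjacencySum G isTree ⟨
    sumFin (λ u → sumFin (adjMatrix G u))
      ≡⟨ ℤΣ.sum-cong-≗ (λ u → ℤΣ.sum-cong-≗ (λ v → χ-sign-split (adj G u v) (±1 u) (±1 v))) ⟩
    sumFin (λ u → sumFin (λ v → Q u v + (N u v + N u v)))
      ≡⟨ ∑∑-distrib-+ Q (λ u v → N u v + N u v) ⟩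
    sumFin (λ u → sumFin (Q u)) + sumFin (λ u → sumFin (λ v → N u v + N u v))
      ≡⟨ cong₂ _+_ (±1-eigenvector-quadraticForm G x eigen ±1) (∑∑-distrib-+ N N) ⟩
    ℤ.+ suc k + (sumFin (λ u → sumFin (N u)) + sumFin (λ u → sumFin (N u)))
      ≡⟨ cong (λ t → ℤ.+ suc k + (t + t)) ΣΣN≡2j ⟩
    ℤ.+ (suc k ℕ.+ ((j ℕ.+ j) ℕ.+ (j ℕ.+ j))) ∎))
  where
  open ≡-Reasoning
  Q N : Fin (suc k) → Fin (suc k) → ℤ
  Q u v = x u * (adjMatrix G u v * x v)
  N u v = ℤ.+ signChanges G x u v

-- Acyclicity of graphs given by a parent map

parentGraph : ∀ {n} → (Fin n → Fin n) → Graph n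
parentGraph parent = record
  { adj    = λ u v → not (does (u ≟ v)) ∧ (does (u ≟ parent v) ∨ does (v ≟ parent u))
  ; sym    = λ u v → cong₂ (λ e d → not e ∧ d) (does-⇔ (mk⇔ sym sym) (u ≟ v) (v ≟ u))
                                               (∨-comm (does (u ≟ parent v)) (does (v ≟ parent u)))
  ; irrefl = λ u → cong (λ e → not e ∧ (does (u ≟ parent u) ∨ does (u ≟ parent u))) (dec-true (u ≟ u) refl)
  }

-- Along a non-backtracking walk the steps towards the root come first: a vertex has a
-- single parent, so after stepping down to a child the walk can only continue downwards.
module ParentForest {n} (parent : Fin n → Fin n) (rank : Fin n → ℕ)
                    (rank-parent : ∀ v → v ≢ parent v → rank (parent v) ℕ.< rank v) where

  G : Graph n
  G = parentGraph parent

  edge-parent : ∀ {a b} → Adj G a b → a ≡ parent b ⊎ b ≡ parent a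
  edge-parent {a} {b} a~b with a ≟ b | a ≟ parent b | b ≟ parent a
  ... | no _ | yes a≡pb | _        = inj₁ a≡pb
  ... | no _ | no _     | yes b≡pa = inj₂ b≡pa

  rank-< : ∀ {a b} → Adj G a b → a ≡ parent b → rank a ℕ.< rank b
  rank-< {b = b} a~b refl = rank-parent b (λ b≡pb → Adj-irrefl G a~b (sym b≡pb))

  rank-> : ∀ {a b} → Adj G a b → b ≡ parent a → rank b ℕ.< rank a
  rank-> {a} {b} a~b = rank-< (Adj-sym G {a} {b} a~b)

  DownEdge : Fin n → Fin n → Set
  DownEdge a b = Adj G a b × a ≡ parent b

  descending : ∀ {a b} rest → Linked (Adj G) (a ∷ b ∷ rest) → NonBacktracking (a ∷ b ∷ rest) →
               a ≡ parent b → Linked DownEdge (a ∷ b ∷ rest)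
  descending []         (a~b ∷ [-])  _          a≡pb = (a~b , a≡pb) ∷ [-]
  descending (c ∷ rest) (a~b ∷ walk) (a≢c , nb) a≡pb with edge-parent (Linked.head walk)
  ... | inj₁ b≡pc = (a~b , a≡pb) ∷ descending rest walk nb b≡pc
  ... | inj₂ c≡pb = ⊥-elim (a≢c (trans a≡pb (sym c≡pb)))

  descending⇒rank< : ∀ {a} xs {z} → Linked DownEdge (a ∷ xs ∷ʳ z) → rank a ℕ.< rank z
  descending⇒rank< []       ((a~z , a≡pz) ∷ [-])  = rank-< a~z a≡pz
  descending⇒rank< (_ ∷ xs) ((a~x , a≡px) ∷ walk) = ℕ.<-trans (rank-< a~x a≡px) (descending⇒rank< xs walk)

  ends-below-or-arrives-down : ∀ {a} xs {p z} → Linked (Adj G) (a ∷ xs ∷ʳ p ∷ʳ z) → NonBacktracking (a ∷ xs ∷ʳ p ∷ʳ z) →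
                           rank z ℕ.< rank a ⊎ p ≡ parent z
  ends-below-or-arrives-down [] (a~p ∷ p~z ∷ [-]) (a≢z , _) with edge-parent p~z
  ... | inj₁ p≡pz = inj₂ p≡pz
  ... | inj₂ z≡pp with edge-parent a~p
  ...   | inj₁ a≡pp = ⊥-elim (a≢z (trans a≡pp (sym z≡pp)))
  ...   | inj₂ p≡pa = inj₁ (ℕ.<-trans (rank-> p~z z≡pp) (rank-> a~p p≡pa))
  ends-below-or-arrives-down (x ∷ xs) (a~x ∷ walk) nb with ends-below-or-arrives-down xs walk (NonBacktracking-tail _ nb)
  ... | inj₂ p≡pz = inj₂ p≡pz
  ... | inj₁ z<x with edge-parent a~x
  ...   | inj₂ x≡pa = inj₁ (ℕ.<-trans z<x (rank-> a~x x≡pa))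
  ...   | inj₁ a≡px with descending _ (a~x ∷ walk) nb a≡px
  ...     | _ ∷ down = ⊥-elim (ℕ.<-asym z<x (descending⇒rank< (xs ∷ʳ _) down))

  -- Read from u, a cycle must leave u towards its parent (a walk that steps down to a child
  -- keeps descending and never comes back to u) and must also return to u from its parent
  -- (otherwise it ends below u), so its second and its last vertex are both u's parent.
  acyclic : ¬ HasCycle G
  acyclic (u , y₁ ∷ ys , 2≤ , simple , walk) =
    impossible ys (initLast ys) 2≤ simple walk (cycle⇒NonBacktracking (y₁ ∷ ys) 2≤ simple)
    where
    impossible : ∀ ys → InitLast ys → 2 ℕ.≤ length (y₁ ∷ ys) → Unique (u ∷ y₁ ∷ ys) →
                 Linked (Adj G) (u ∷ (y₁ ∷ ys) ∷ʳ u) → NonBacktracking (u ∷ (y₁ ∷ ys) ∷ʳ u) → ⊥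
    impossible .[] [] (s≤s ()) _ _ _
    impossible .(zs ∷ʳ yₖ) (zs ∷ʳ′ yₖ) _ (_ ∷ (y₁∉ ∷ _)) walk nb with ends-below-or-arrives-down (y₁ ∷ zs) walk nb
    ... | inj₁ u<u = ℕ.<-irrefl refl u<u
    ... | inj₂ yₖ≡pu with edge-parent (Linked.head walk)
    ...   | inj₂ y₁≡pu = All.head (All.++⁻ʳ zs y₁∉) (trans y₁≡pu (sym yₖ≡pu))
    ...   | inj₁ u≡py₁ = ℕ.<-irrefl refl (descending⇒rank< (y₁ ∷ zs ∷ʳ yₖ) (descending _ walk nb u≡py₁))

-- The trees of order 4m + 2

pattern old i = suc (suc (suc (suc i)))

-- tree (suc m) hangs a leaf 0F and a vertex 1F carrying two leaves 2F, 3F on the root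
-- of tree m, whose vertices become old i.
root : ∀ m → Fin (order m)
root zero    = zero
root (suc m) = old (root m)

parent : ∀ m → Fin (order m) → Fin (order m)
parent zero    _       = zero
parent (suc m) 0F      = root (suc m)
parent (suc m) 1F      = root (suc m)
parent (suc m) 2F      = 1F
parent (suc m) 3F      = 1F
parent (suc m) (old i) = old (parent m i)

depth : ∀ m → Fin (order m) → ℕ
depth zero    i       = toℕ i
depth (suc m) 0F      = 1
depth (suc m) 1F      = 1
depth (suc m) 2F      = 2
depth (suc m) 3F      = 2
depth (suc m) (old i) = depth m i

depth-root : ∀ m → depth m (root m) ≡ 0
depth-root zero    = refl
depth-root (suc m) = depth-root m

depth-parent : ∀ m v → v ≢ parent m v → depth m (parent m v) ℕ.< depth m v
depth-parent zero    0F      v≢pv = ⊥-elim (v≢pv refl)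
depth-parent zero    1F      _    = s≤s z≤n
depth-parent (suc m) 0F      _    = subst (ℕ._< 1) (sym (depth-root m)) (s≤s z≤n)
depth-parent (suc m) 1F      _    = subst (ℕ._< 1) (sym (depth-root m)) (s≤s z≤n)
depth-parent (suc m) 2F      _    = s≤s (s≤s z≤n)
depth-parent (suc m) 3F      _    = s≤s (s≤s z≤n)
depth-parent (suc m) (old i) i≢pi = depth-parent m i (i≢pi ∘ cong old)

tree : ∀ m → Graph (order m)
tree m = parentGraph (parent m)

signs : ∀ m → Fin (order m) → ℤ
signs zero    _       = 1ℤ
signs (suc m) 0F      = 1ℤ
signs (suc m) (old i) = signs m i
signs (suc m) _       = -1ℤ

signs-root : ∀ m → signs m (root m) ≡ 1ℤ
signs-root zero    = refl
signs-root (suc m) = signs-root m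

signs-±1 : ∀ m → PlusMinusOne (signs m)
signs-±1 zero    _       = inj₁ refl
signs-±1 (suc m) 0F      = inj₁ refl
signs-±1 (suc m) 1F      = inj₂ refl
signs-±1 (suc m) 2F      = inj₂ refl
signs-±1 (suc m) 3F      = inj₂ refl
signs-±1 (suc m) (old i) = signs-±1 m i

-- 0F and 1F are both joined to the root or to neither, so their signs cancel.
new-neighbours-cancel : ∀ b t → χ b * 1ℤ + (χ b * -1ℤ + (0ℤ + (0ℤ + t))) ≡ t
new-neighbours-cancel false = ℤ-solve-∀
new-neighbours-cancel true  = ℤ-solve-∀

root-sum : ∀ m → sumFin (λ j → δ j (root m) * signs m j) ≡ 1ℤ
root-sum m = trans (sum-δ (root m) (signs m)) (signs-root m)

-- The first four summands belong to the new vertices 0F, 1F, 2F, 3F, the rest to tree m.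
signs-eigen : ∀ m u → sumFin (λ v → adjMatrix (tree m) u v * signs m v) ≡ 1ℤ * signs m u
signs-eigen zero    0F      = refl
signs-eigen zero    1F      = refl
signs-eigen (suc m) 0F      = cong (λ t → 0ℤ + (0ℤ + (0ℤ + (0ℤ + t)))) (root-sum m)
signs-eigen (suc m) 1F      = cong (λ t → 0ℤ + (0ℤ + (-1ℤ + (-1ℤ + t)))) (root-sum m)
signs-eigen (suc m) 2F      = cong (λ t → 0ℤ + (-1ℤ + (0ℤ + (0ℤ + t)))) (sum-zero {order m} λ _ → refl)
signs-eigen (suc m) 3F      = cong (λ t → 0ℤ + (-1ℤ + (0ℤ + (0ℤ + t)))) (sum-zero {order m} λ _ → refl)
signs-eigen (suc m) (old i) = trans (new-neighbours-cancel (does (i ≟ root m) ∨ false) _) (signs-eigen m i)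

path-to-root : ∀ m v → Star (Adj (tree m)) v (root m)
path-to-root zero    0F      = ε
path-to-root zero    1F      = tt ◅ ε
path-to-root (suc m) 0F      = subst T (sym (dec-true (root m ≟ root m) refl)) tt ◅ ε
path-to-root (suc m) 1F      = subst T (sym (dec-true (root m ≟ root m) refl)) tt ◅ ε
path-to-root (suc m) 2F      = tt ◅ path-to-root (suc m) 1F
path-to-root (suc m) 3F      = tt ◅ path-to-root (suc m) 1F
path-to-root (suc m) (old i) = Star.gmap old id (path-to-root m i)

eigentree : ∀ m → EigenTree (order m)
eigentree m = tree m , (connected , ParentForest.acyclic (parent m) (depth m) (depth-parent m))
            , signs m , ((root m , subst (_≢ 0ℤ) (sym (signs-root m)) λ ()) , signs-eigen m) , signs-±1 m
  where
  connected : Connected (tree m)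
  connected u v = Star⇒Linked (path-to-root m u ◅◅ Star.reverse (λ {a} {b} → Adj-sym (tree m) {a} {b})
                                                                 (path-to-root m v))

order-mod-4 : ∀ j → order j % 4 ≡ 2
order-mod-4 j = [m+kn]%n≡m%n 2 j 4

mod-4⇒order : ∀ n → n % 4 ≡ 2 → n ≡ order (n / 4)
mod-4⇒order n n%4≡2 = trans (m≡m%n+[m/n]*n n 4) (cong (ℕ._+ n / 4 ℕ.* 4) n%4≡2)

mainTheorem5 : (n : ℕ) →
    (Σ (Graph n) λ G → IsTree G × Σ (Fin n → ℤ) λ x → IsEigenvector G x 1ℤ × PlusMinusOne x)
      ⇔ (n % 4 ≡ 2)
mainTheorem5 n = mk⇔ necessary sufficient
  where
  necessary : EigenTree n → n % 4 ≡ 2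
  necessary eigenTree = let j , n≡order = ±1-eigentree⇒order eigenTree
                        in subst (λ k → k % 4 ≡ 2) (sym n≡order) (order-mod-4 j)
  sufficient : n % 4 ≡ 2 → EigenTree n
  sufficient n%4≡2 = subst EigenTree (sym (mod-4⇒order n n%4≡2)) (eigentree (n / 4))
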